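{- Let $m\ge 3$ be an integer, let $a_1,a_2,a_3$ be positive integers, and let $f=a_1P_m(x_1)+a_2P_m(x_2)+a_3P_m(x_3)$, where $P_m(x)=\frac{(m-2)x^2-(m-4)x}{2}$. Let $L=\mathbb{Z}\mathbf{e}_1+\mathbb{Z}\mathbf{e}_2+\mathbb{Z}\mathbf{e}_3$ be the $\mathbb{Z}$-lattice with Gram matrix $(B(\mathbf{e}_i,\mathbf{e}_j))_{1\le i,j\le 3}=\mathrm{diag}(a_1c^2,a_2c^2,a_3c^2)$ and let $\mathbf{v}=-\frac{d}{c}(\mathbf{e}_1+\mathbf{e}_2+\mathbf{e}_3)\in\mathbb{Q}L$. Then $f$ is regular if and only if the $\mathbb{Z}$-coset $L+\mathbf{v}$ is tight regular.
   Context: Define $\delta=4$ if $m$ is odd, $\delta=2$ if $m\equiv 2\pmod 4$, $\delta=1$ if $m\equiv 0\pmod 4$; and $c=\delta\frac{m-2}{2}$, $d=\delta\frac{m-4}{4}$ (integers). An integer $n$ is locally represented by a polynomial $f$ if $f(x)=n$ is solvable over $\mathbb{Z}_p$ for every prime $p$ and over $\mathbb{R}$; $f$ is regular if it represents over $\mathbb{Z}$ every nonnegative integer locally represented by $f$. For a positive definite quadratic space $V$ over $\mathbb{Q}$ with quadratic map $Q$ and $B(\mathbf{x},\mathbf{y})=\frac12(Q(\mathbf{x}+\mathbf{y})-Q(\mathbf{x})-Q(\mathbf{y}))$, a $\mathbb{Z}$-coset is a set $L+\mathbf{v}=\{\mathbf{x}+\mathbf{v}:\mathbf{x}\in L\}$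 with $L$ a $\mathbb{Z}$-lattice and $\mathbf{v}\in\mathbb{Q}L$. An integer $n$ is represented by $L+\mathbf{v}$ if $Q(\mathbf{x}+\mathbf{v})=n$ for some $\mathbf{x}\in L$, and is locally represented by $L+\mathbf{v}$ if for every prime $p$ there is $\mathbf{x}_p\in L_p=L\otimes\mathbb{Z}_p$ with $Q(\mathbf{x}_p+\mathbf{v})=n$. Let $\min(L+\mathbf{v})=\min\{Q(\mathbf{x}+\mathbf{v}):\mathbf{x}\in L\}$. The coset $L+\mathbf{v}$ is tight regular if it represents every integer $n\ge\min(L+\mathbf{v})$ that it locally represents. -}

module Defs where

open import Data.Nat as ℕ using (ℕ; zero; suc; _≤_)
open import Data.Nat.Primality using (Prime)
open import Data.Integer as ℤ using (ℤ; +_; _-_; _*_; _+_; -_; _/_)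
open import Data.Integer.Divisibility as ℤD using ()
open import Data.Fin using (Fin; zero; suc)
open import Data.Product using (Σ; ∃; _×_)

δ : ℕ → ℕ
δ m with m ℕ.% 4
... | 0 = 1
... | 2 = 2
... | _ = 4

-- c = δ (m-2)/2   (exact division; m ≥ 3 in all uses)
cConst : ℕ → ℤ
cConst m = ((+ δ m) * (+ m - + 2)) / + 2

-- d = δ (m-4)/4   (exact division; may be negative)
dConst : ℕ → ℤ
dConst m = ((+ δ m) * (+ m - + 4)) / + 4

-- P_m(x) = ((m-2)x² - (m-4)x)/2 ; the numerator is always even, so the
-- integer division is exact.
P : ℕ → ℤ → ℤ
P m x = ((+ m - + 2) * x * x - (+ m - + 4) * x) / + 2

f : ℕ → (Fin 3 → ℕ) → (Fin 3 → ℤ) → ℤ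
f m a x = + a zero * P m (x zero)
        + + a (suc zero) * P m (x (suc zero))
        + + a (suc (suc zero)) * P m (x (suc (suc zero)))

-- L = ℤe₁+ℤe₂+ℤe₃ with Gram matrix diag(a₁c², a₂c², a₃c²) and
-- v = -(d/c)(e₁+e₂+e₃).  For x = Σ xᵢeᵢ (xᵢ in ℤ or ℤ_p),
--   Q(x + v) = Σ aᵢ c² (xᵢ - d/c)² = Σ aᵢ (c xᵢ - d)²,
-- which is written out below (integer coefficients).
Qcoset : ℕ → (Fin 3 → ℕ) → (Fin 3 → ℤ) → ℤ
Qcoset m a x = term zero + term (suc zero) + term (suc (suc zero))
  where
  term : Fin 3 → ℤ
  term i = + a i * ((cConst m * x i - dConst m) * (cConst m * x i - dConst m))

-- An element of ℤ_p is presented by integers xₖ with xₖ₊₁ ≡ xₖ (mod pᵏ).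
record ℤ[_] (p : ℕ) : Set where
  field
    seq    : ℕ → ℤ
    compat : ∀ k → (+ (p ℕ.^ k)) ℤD.∣ (seq (suc k) - seq k)

open ℤ[_] public

-- For an integer-valued polynomial F in three variables (hence p-adically
-- continuous), the equation F(x) = n holds in ℤ_p for x ∈ ℤ_p³ iff
-- F(x⁽ᵏ⁾) → n p-adically along the approximating integer vectors.
SolvesAt : (p : ℕ) → ((Fin 3 → ℤ) → ℤ) → (Fin 3 → ℤ[ p ]) → ℤ → Set
SolvesAt p F x n =
  ∀ j → ∃ λ K → ∀ k → K ≤ k →
    (+ (p ℕ.^ j)) ℤD.∣ (F (λ i → seq (x i) k) - n)

SolvableOverℤp : (p : ℕ) → ((Fin 3 → ℤ) → ℤ) → ℤ → Set
SolvableOverℤp p F n = ∃ λ (x : Fin 3 → ℤ[ p ]) → SolvesAt p F x n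

Represents : ((Fin 3 → ℤ) → ℤ) → ℤ → Set
Represents F n = ∃ λ (x : Fin 3 → ℤ) → F x ≡ n
  where open import Relation.Binary.PropositionalEquality using (_≡_)

-- n locally represented by f, for n ≥ 0: solvable over every ℤ_p.
-- (Solvability over ℝ is automatic for n ≥ 0 since f(0)=0 and f is
-- continuous and unbounded above.)
LocallyRepresentedByF : ℕ → (Fin 3 → ℕ) → ℕ → Set
LocallyRepresentedByF m a n =
  ∀ p → Prime p → SolvableOverℤp p (f m a) (+ n)

IsRegular : ℕ → (Fin 3 → ℕ) → Set
IsRegular m a =
  ∀ (n : ℕ) → LocallyRepresentedByF m a n → Represents (f m a) (+ n)

LocallyRepresentedByCoset : ℕ → (Fin 3 → ℕ) → ℤ → Set
LocallyRepresentedByCoset m a n =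
  ∀ p → Prime p → SolvableOverℤp p (Qcoset m a) n

IsMinCoset : ℕ → (Fin 3 → ℕ) → ℤ → Set
IsMinCoset m a μ =
  Represents (Qcoset m a) μ × (∀ (x : Fin 3 → ℤ) → μ ℤ.≤ Qcoset m a x)

IsTightRegular : ℕ → (Fin 3 → ℕ) → Set
IsTightRegular m a =
  ∀ (μ : ℤ) → IsMinCoset m a μ →
  ∀ (n : ℤ) → μ ℤ.≤ n → LocallyRepresentedByCoset m a n →
  Represents (Qcoset m a) n

{-# OPTIONS --safe #-}
-- Completing the square, Q(x + v) = Σ aᵢ (c xᵢ − d)² = δc · f(x) + (a₁ + a₂ + a₃) d², because
-- 2c = δ(m − 2) and 4d = δ(m − 4).  So the values of L + v are an affine image of the values of f,
-- with slope δc > 0, and since f ≥ 0 and f(0) = 0 the minimum of L + v is D = (a₁ + a₂ + a₃) d².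
-- The map n ↦ δc · n + D therefore matches the integers represented by f with those ≥ D
-- represented by L + v, globally and p-adically.  The one arithmetic point is that an integer n
-- locally represented by L + v lies in the image: δc · y ≡ n − D is solvable modulo every prime
-- power, which forces δc ∣ n − D (peel off one prime factor of δc at a time); and a p-adic
-- solution of δc · f(x) = δc · q solves f(x) = q, because p^(δc + j) ∣ δc · y implies p^j ∣ y.
module Submission where

open import Defs
open import Data.Nat using (ℕ; _≤_; _<_)
open import Data.Fin using (Fin; zero; suc)
open import Data.Integer using (0ℤ)
open import Data.Product using (_,_)
open import Function.Bundles using (_⇔_; mk⇔)

module _ where
  open import Data.Nat using (zero; suc; _+_; _*_; _^_; NonZero; s≤s; z≤n; nonTrivial⇒n>1)
  open import Data.Nat.Properties using (≤-<-trans; n<1+n; ^-monoʳ-<; *-comm; ^-distribˡ-+-*; <⇒≱)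
  open import Data.Nat.Divisibility
  open import Data.Nat.Primality using (Prime; euclidsLemma; prime⇒nonZero; prime⇒nonTrivial)
  open import Data.Nat.Tactic.RingSolver using (solve-∀)
  open import Data.Sum using (inj₁; inj₂)
  open import Relation.Nullary using (contradiction; yes; no)
  open import Relation.Binary.PropositionalEquality using (_≡_; refl; subst)

  n<m^n : ∀ {m} → 1 < m → ∀ n → n < m ^ n
  n<m^n 1<m zero    = s≤s z≤n
  n<m^n 1<m (suc n) = ≤-<-trans (n<m^n 1<m n) (^-monoʳ-< _ 1<m (n<1+n n))

  module _ {p : ℕ} (p-prime : Prime p) where
    private instance
      p≢0 : NonZero p
      p≢0 = prime⇒nonZero p-prime

    p∤m∧p^j∣m*n⇒p^j∣n : ∀ {m n} j → p ∤ m → p ^ j ∣ m * n → p ^ j ∣ n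
    p∤m∧p^j∣m*n⇒p^j∣n zero    _   _ = 1∣ _
    p∤m∧p^j∣m*n⇒p^j∣n {m} {n} (suc j) p∤m p^[1+j]∣mn
      with euclidsLemma m n p-prime (∣-trans (m∣m*n (p ^ j)) p^[1+j]∣mn)
    ... | inj₁ p∣m              = contradiction p∣m p∤m
    ... | inj₂ (divides n′ refl) = subst (p ^ suc j ∣_) (*-comm p n′) (*-monoʳ-∣ p p^j∣n′)
      where
      rearrange : ∀ m n′ p → m * (n′ * p) ≡ p * (m * n′)
      rearrange = solve-∀
      p^j∣n′ : p ^ j ∣ n′
      p^j∣n′ = p∤m∧p^j∣m*n⇒p^j∣n j p∤m
        (*-cancelˡ-∣ p (subst (p ^ suc j ∣_) (rearrange m n′ p) p^[1+j]∣mn))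

    p^k∤m∧p^[k+j]∣m*n⇒p^j∣n : ∀ {m n} k j → p ^ k ∤ m → p ^ (k + j) ∣ m * n → p ^ j ∣ n
    p^k∤m∧p^[k+j]∣m*n⇒p^j∣n zero j p^0∤m _ = contradiction (1∣ _) p^0∤m
    p^k∤m∧p^[k+j]∣m*n⇒p^j∣n {m} {n} (suc k) j p^[1+k]∤m p^[1+k+j]∣mn with p ∣? m
    ... | no p∤m =
      p∤m∧p^j∣m*n⇒p^j∣n j p∤m (∣-trans (divides (p ^ suc k) (^-distribˡ-+-* p (suc k) j)) p^[1+k+j]∣mn)
    ... | yes (divides m′ refl) =
      p^k∤m∧p^[k+j]∣m*n⇒p^j∣n k j p^k∤m′
        (*-cancelˡ-∣ p (subst (p ^ suc (k + j) ∣_) (rearrange m′ p n) p^[1+k+j]∣mn))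
      where
      rearrange : ∀ m′ p n → m′ * p * n ≡ p * (m′ * n)
      rearrange = solve-∀
      p^k∤m′ : p ^ k ∤ m′
      p^k∤m′ p^k∣m′ = p^[1+k]∤m (subst (_∣ m′ * p) (*-comm (p ^ k) p) (*-monoˡ-∣ p p^k∣m′))

    p^m∤m : ∀ {m} .{{_ : NonZero m}} → p ^ m ∤ m
    p^m∤m {m} p^m∣m = <⇒≱ (n<m^n (nonTrivial⇒n>1 p {{prime⇒nonTrivial p-prime}}) m) (∣⇒≤ p^m∣m)

    p^[m+j]∣m*n⇒p^j∣n : ∀ {m n} .{{_ : NonZero m}} j → p ^ (m + j) ∣ m * n → p ^ j ∣ n
    p^[m+j]∣m*n⇒p^j∣n {m} j = p^k∤m∧p^[k+j]∣m*n⇒p^j∣n m j p^m∤m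

module _ where
  open import Data.Nat as ℕ using (_^_; NonZero)
  open import Data.Nat.Divisibility as ℕ using ()
  import Data.Nat.Properties as ℕ
  open import Data.Nat.Primality using (Prime; prime⇒nonZero)
  open import Data.Nat.Primality.Factorisation using (factorise)
  open import Data.Nat.ListAction using (product)
  open import Data.List using ([]; _∷_)
  open import Data.List.Relation.Unary.All using (All; []; _∷_)
  open import Data.Integer using (ℤ; +_; _-_; _*_; ∣_∣)
  import Data.Integer.Properties as ℤ
  open import Data.Integer.Divisibility using (_∣_)
  import Data.Integer.Divisibility.Signed as Signed
  open import Data.Product using (∃)
  open import Relation.Binary.PropositionalEquality using (_≡_; refl; subst; cong; trans)
  open import Data.Integer.Tactic.RingSolver using (solve-∀)

  SolvableModPrimePowers : ℕ → ℤ → Set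
  SolvableModPrimePowers C N = ∀ p → Prime p → ∀ j → ∃ λ y → + (p ^ j) ∣ + C * y - N

  private
    solvableModPrimePowers[q*C]⇒q∣N : ∀ {q} C N → Prime q → SolvableModPrimePowers (q ℕ.* C) N →
                                      Signed._∣_ (+ q) N
    solvableModPrimePowers[q*C]⇒q∣N {q} C N q-prime solvable with solvable q q-prime 1
    ... | y , q¹∣qCy-N =
      subst (Signed._∣_ (+ q)) (cancel (+ (q ℕ.* C) * y) N) (Signed.∣m∣n⇒∣m-n q∣qCy q∣qCy-N)
      where
      cancel : ∀ x n → x - (x - n) ≡ n
      cancel = solve-∀
      q∣qCy : Signed._∣_ (+ q) (+ (q ℕ.* C) * y)
      q∣qCy = Signed.∣m⇒∣m*n y (Signed.∣ᵤ⇒∣ {+ q} {+ (q ℕ.* C)} (ℕ.m∣m*n C))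
      q∣qCy-N : Signed._∣_ (+ q) (+ (q ℕ.* C) * y - N)
      q∣qCy-N = Signed.∣ᵤ⇒∣ {+ q}
        (subst (ℕ._∣ ∣ + (q ℕ.* C) * y - N ∣) (ℕ.*-identityʳ q) q¹∣qCy-N)

    solvableModPrimePowers⇒product∣ : ∀ {ps} → All Prime ps → ∀ N →
                                       SolvableModPrimePowers (product ps) N → + product ps ∣ N
    solvableModPrimePowers⇒product∣ [] N _ = ℕ.1∣ ∣ N ∣
    solvableModPrimePowers⇒product∣ {q ∷ qs} (q-prime ∷ qs-prime) N solvable
      with solvableModPrimePowers[q*C]⇒q∣N (product qs) N q-prime solvable
    ... | Signed.divides N′ refl = begin
      q ℕ.* C′      ∣⟨ ℕ.*-monoʳ-∣ q (solvableModPrimePowers⇒product∣ qs-prime N′ solvable′) ⟩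
      q ℕ.* ∣ N′ ∣  ≡⟨ ℕ.*-comm q ∣ N′ ∣ ⟩
      ∣ N′ ∣ ℕ.* q  ≡⟨ ℤ.abs-* N′ (+ q) ⟨
      ∣ N′ * + q ∣  ∎
      where
      open ℕ.∣-Reasoning
      instance _ = prime⇒nonZero q-prime
      C′ = product qs
      factor : ∀ q c y n → q * c * y - n * q ≡ q * (c * y - n)
      factor = solve-∀
      rescale : ∀ y → ∣ + (q ℕ.* C′) * y - N′ * + q ∣ ≡ q ℕ.* ∣ + C′ * y - N′ ∣
      rescale y = trans (cong (λ c → ∣ c * y - N′ * + q ∣) (ℤ.pos-* q C′))
                        (trans (cong ∣_∣ (factor (+ q) (+ C′) y N′)) (ℤ.abs-* (+ q) _))
      solvable′ : SolvableModPrimePowers C′ N′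
      solvable′ p p-prime j with solvable p p-prime (q ℕ.+ j)
      ... | y , p^[q+j]∣ =
        y , p^[m+j]∣m*n⇒p^j∣n p-prime j (subst (ℕ._∣_ (p ^ (q ℕ.+ j))) (rescale y) p^[q+j]∣)

  solvableModPrimePowers⇒∣ : ∀ C .{{_ : NonZero C}} N → SolvableModPrimePowers C N → + C ∣ N
  solvableModPrimePowers⇒∣ C N with factorise C
  ... | record { factors = ps ; isFactorisation = refl ; factorsPrime = ps-prime } =
    solvableModPrimePowers⇒product∣ ps-prime N

module _ where
  open import Data.Nat as ℕ using (zero; suc; NonZero; z≤n; s≤s)
  import Data.Nat.Properties as ℕ
  open import Data.Integer as ℤ using (ℤ; +_; _+_; _-_; _*_; _/_; _%_; ∣_∣; 1ℤ; +≤+)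
  import Data.Integer.Properties as ℤ
  open import Data.Integer.DivMod using (a≡a%n+[a/n]*n; n%d<d)
  open import Data.Integer.Divisibility.Signed using (_∣_; divides)
  open import Relation.Binary.PropositionalEquality
  open import Data.List using ([]; _∷_)
  open import Data.Integer.Tactic.RingSolver using (solve; solve-∀)
  open ≡-Reasoning

  i*n/n≡i : ∀ i n .{{_ : NonZero n}} → i * + n / + n ≡ i
  i*n/n≡i i n = sym (ℤ.i-j≡0⇒i≡j i q (ℤ.∣i∣≡0⇒i≡0 (ℕ.n<1⇒n≡0 ∣i-q∣<1)))
    where
    q = i * + n / + n
    r = i * + n % + n
    [i-q]*n≡r : (i - q) * + n ≡ + r
    [i-q]*n≡r = begin
      (i - q) * + n            ≡⟨ distribute i q (+ n) ⟩
      i * + n - q * + n        ≡⟨ cong (_- q * + n) (a≡a%n+[a/n]*n (i * + n) (+ n)) ⟩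
      + r + q * + n - q * + n  ≡⟨ cancel (+ r) (q * + n) ⟩
      + r                      ∎
      where
      distribute : ∀ i q n → (i - q) * n ≡ i * n - q * n
      distribute = solve-∀
      cancel : ∀ r x → r + x - x ≡ r
      cancel = solve-∀
    ∣i-q∣*n<1*n : ∣ i - q ∣ ℕ.* n ℕ.< 1 ℕ.* n
    ∣i-q∣*n<1*n = subst₂ ℕ._<_ (trans (cong ∣_∣ (sym [i-q]*n≡r)) (ℤ.abs-* (i - q) (+ n)))
                              (sym (ℕ.*-identityˡ n)) (n%d<d (i * + n) (+ n))
    ∣i-q∣<1 : ∣ i - q ∣ ℕ.< 1
    ∣i-q∣<1 = ℕ.*-cancelʳ-< n _ _ ∣i-q∣*n<1*n

  i/n*n≡i : ∀ {i} n .{{_ : NonZero n}} → + n ∣ i → i / + n * + n ≡ i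
  i/n*n≡i n (divides q refl) = cong (_* + n) (i*n/n≡i q n)

  data Parity : ℤ → Set where
    even : ∀ q → Parity (q * + 2)
    odd  : ∀ q → Parity (+ 1 + q * + 2)

  parity : ∀ i → Parity i
  parity i with i % + 2 | n%d<d i (+ 2) | a≡a%n+[a/n]*n i (+ 2)
  ... | 0 | _ | i≡ = subst Parity (sym (trans i≡ (ℤ.+-identityˡ _))) (even (i / + 2))
  ... | 1 | _ | i≡ = subst Parity (sym i≡) (odd (i / + 2))
  ... | suc (suc _) | s≤s (s≤s ()) | _

  0≤i+j : ∀ {i j} → 0ℤ ℤ.≤ i → 0ℤ ℤ.≤ j → 0ℤ ℤ.≤ i + j
  0≤i+j {i} {j} = ℤ.+-mono-≤ {0ℤ} {i} {0ℤ} {j}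

  0≤i*j : ∀ {i j} → 0ℤ ℤ.≤ i → 0ℤ ℤ.≤ j → 0ℤ ℤ.≤ i * j
  0≤i*j {+ a} {+ b} (+≤+ _) (+≤+ _) = subst (0ℤ ℤ.≤_) (ℤ.pos-* a b) (+≤+ z≤n)

  0≤i*[i-1] : ∀ i → 0ℤ ℤ.≤ i * (i - 1ℤ)
  0≤i*[i-1] (+ zero)   = +≤+ z≤n
  0≤i*[i-1] (+ suc k)  = 0≤i*j {+ suc k} {+ k} (+≤+ z≤n) (+≤+ z≤n)
  0≤i*[i-1] ℤ.-[1+ k ] = +≤+ z≤n

  completeSquare : ∀ k c d M y p → c * + 2 ≡ k * (M - + 2) → d * + 4 ≡ k * (M - + 4) →
                   p * + 2 ≡ (M - + 2) * y * y - (M - + 4) * y →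
                   (c * y - d) * (c * y - d) ≡ k * c * p + d * d
  completeSquare k c d M y p c*2≡ d*4≡ p*2≡ = ℤ.*-cancelʳ-≡ _ _ (+ 2) (begin
    (c * y - d) * (c * y - d) * + 2                            ≡⟨ solve (c ∷ d ∷ y ∷ []) ⟩
    c * y * (c * + 2 * y - d * + 4) + d * d * + 2              ≡⟨ cong₂ (λ u v → c * y * (u * y - v) + d * d * + 2) c*2≡ d*4≡ ⟩
    c * y * (k * (M - + 2) * y - k * (M - + 4)) + d * d * + 2  ≡⟨ solve (k ∷ c ∷ d ∷ M ∷ y ∷ []) ⟩
    k * c * ((M - + 2) * y * y - (M - + 4) * y) + d * d * + 2  ≡⟨ cong (λ u → k * c * u + d * d * + 2) p*2≡ ⟨
    k * c * (p * + 2) + d * d * + 2                            ≡⟨ solve (k ∷ c ∷ d ∷ p ∷ []) ⟩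
    (k * c * p + d * d) * + 2                                  ∎)

module _ where
  open import Data.Nat as ℕ using (zero; suc; NonZero; z≤n; s≤s)
  open import Data.Nat.DivMod as ℕ using ()
  import Data.Nat.Properties as ℕ
  open import Data.Integer as ℤ using (ℤ; +_; _+_; _-_; _*_; _/_; _/ℕ_; ∣_∣; 1ℤ; +≤+)
  import Data.Integer.Properties as ℤ
  open import Data.Integer.DivMod using (a≡a%ℕn+[a/ℕn]*n; 0≤n⇒0≤n/d)
  open import Data.Integer.Divisibility.Signed using (_∣_; divides)
  open import Data.List using ([]; _∷_)
  open import Relation.Binary.PropositionalEquality
  open import Data.Integer.Tactic.RingSolver using (solve; solve-∀)

  -- The second index is the value of δ on the residue class of the first.
  data Residue4 : ℤ → ℕ → Set where
    4q   : ∀ q → Residue4 (q * + 4) 1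
    4q+1 : ∀ q → Residue4 (+ 1 + q * + 4) 4
    4q+2 : ∀ q → Residue4 (+ 2 + q * + 4) 2
    4q+3 : ∀ q → Residue4 (+ 3 + q * + 4) 4

  residue4 : ∀ m → Residue4 (+ m) (δ m)
  residue4 m with m ℕ.% 4 | ℕ.m%n<n m 4 | a≡a%ℕn+[a/ℕn]*n (+ m) 4
  ... | 0 | _ | m≡ = subst (λ M → Residue4 M 1) (sym (trans m≡ (ℤ.+-identityˡ _))) (4q (+ m /ℕ 4))
  ... | 1 | _ | m≡ = subst (λ M → Residue4 M 4) (sym m≡) (4q+1 (+ m /ℕ 4))
  ... | 2 | _ | m≡ = subst (λ M → Residue4 M 2) (sym m≡) (4q+2 (+ m /ℕ 4))
  ... | 3 | _ | m≡ = subst (λ M → Residue4 M 4) (sym m≡) (4q+3 (+ m /ℕ 4))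
  ... | suc (suc (suc (suc _))) | s≤s (s≤s (s≤s (s≤s ()))) | _

  2∣d*[M-2] : ∀ {M d} → Residue4 M d → + 2 ∣ + d * (M - + 2)
  2∣d*[M-2] (4q   q) = divides (q * + 2 - + 1) (solve (q ∷ []))
  2∣d*[M-2] (4q+1 q) = divides ((q * + 4 - + 1) * + 2) (solve (q ∷ []))
  2∣d*[M-2] (4q+2 q) = divides (q * + 4) (solve (q ∷ []))
  2∣d*[M-2] (4q+3 q) = divides ((q * + 4 + + 1) * + 2) (solve (q ∷ []))

  4∣d*[M-4] : ∀ {M d} → Residue4 M d → + 4 ∣ + d * (M - + 4)
  4∣d*[M-4] (4q   q) = divides (q - + 1) (solve (q ∷ []))
  4∣d*[M-4] (4q+1 q) = divides (q * + 4 - + 3) (solve (q ∷ []))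
  4∣d*[M-4] (4q+2 q) = divides (q * + 2 - + 1) (solve (q ∷ []))
  4∣d*[M-4] (4q+3 q) = divides (q * + 4 - + 1) (solve (q ∷ []))

  cConst*2≡δ*[m-2] : ∀ m → cConst m * + 2 ≡ + δ m * (+ m - + 2)
  cConst*2≡δ*[m-2] m = i/n*n≡i 2 (2∣d*[M-2] (residue4 m))

  dConst*4≡δ*[m-4] : ∀ m → dConst m * + 4 ≡ + δ m * (+ m - + 4)
  dConst*4≡δ*[m-4] m = i/n*n≡i 4 (4∣d*[M-4] (residue4 m))

  2∣[M-2]*x*x-[M-4]*x : ∀ M {x} → Parity x → + 2 ∣ (M - + 2) * x * x - (M - + 4) * x
  2∣[M-2]*x*x-[M-4]*x M (even q) = divides ((M - + 2) * q * q * + 2 - (M - + 4) * q) (solve (M ∷ q ∷ []))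
  2∣[M-2]*x*x-[M-4]*x M (odd q)  = divides ((+ 1 + q * + 2) * ((M - + 2) * q + + 1)) (solve (M ∷ q ∷ []))

  P*2≡[m-2]*x*x-[m-4]*x : ∀ m x → P m x * + 2 ≡ (+ m - + 2) * x * x - (+ m - + 4) * x
  P*2≡[m-2]*x*x-[m-4]*x m x = i/n*n≡i 2 (2∣[M-2]*x*x-[M-4]*x (+ m) (parity x))

  δ-nonZero : ∀ m → NonZero (δ m)
  δ-nonZero m with m ℕ.% 4
  ... | 0                 = _
  ... | 1                 = _
  ... | 2                 = _
  ... | suc (suc (suc _)) = _

  cConst>0 : ∀ {m} → 3 ≤ m → 0ℤ ℤ.< cConst m
  cConst>0 {m} (s≤s (s≤s (s≤s {n = k} _))) = ℤ.*-cancelʳ-<-nonNeg (+ 2)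
    (subst (0ℤ ℤ.<_) (trans (ℤ.pos-* (δ m) (suc k)) (sym (cConst*2≡δ*[m-2] m)))
           (ℤ.+<+ (ℕ.>-nonZero⁻¹ _ {{ℕ.m*n≢0 (δ m) (suc k) {{δ-nonZero m}}}})))

  scale : ℕ → ℕ
  scale m = δ m ℕ.* ∣ cConst m ∣

  scale-nonZero : ∀ {m} → 3 ≤ m → NonZero (scale m)
  scale-nonZero {m} 3≤m = ℕ.m*n≢0 (δ m) ∣ cConst m ∣ {{δ-nonZero m}} {{ℤ.>-nonZero (cConst>0 3≤m)}}

  +scale≡δ*cConst : ∀ {m} → 3 ≤ m → + scale m ≡ + δ m * cConst m
  +scale≡δ*cConst {m} 3≤m =
    trans (ℤ.pos-* (δ m) ∣ cConst m ∣) (cong (+ δ m *_) (ℤ.0≤i⇒+∣i∣≡i (ℤ.<⇒≤ (cConst>0 3≤m))))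

  offset : ℕ → (Fin 3 → ℕ) → ℤ
  offset m a = (+ a zero + + a (suc zero) + + a (suc (suc zero))) * (dConst m * dConst m)

  Qcoset≡δ*cConst*f+offset : ∀ m a x → Qcoset m a x ≡ + δ m * cConst m * f m a x + offset m a
  Qcoset≡δ*cConst*f+offset m a x = trans
    (cong₂ _+_ (cong₂ _+_ (cong (+ a zero *_) (square≡ (x zero)))
                          (cong (+ a (suc zero) *_) (square≡ (x (suc zero)))))
               (cong (+ a (suc (suc zero)) *_) (square≡ (x (suc (suc zero))))))
    (collect (+ a zero) (+ a (suc zero)) (+ a (suc (suc zero)))
             (P m (x zero)) (P m (x (suc zero))) (P m (x (suc (suc zero))))
             (+ δ m * cConst m) (dConst m * dConst m))
    where
    square≡ : ∀ y → (cConst m * y - dConst m) * (cConst m * y - dConst m)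
                  ≡ + δ m * cConst m * P m y + dConst m * dConst m
    square≡ y = completeSquare (+ δ m) (cConst m) (dConst m) (+ m) y (P m y)
                  (cConst*2≡δ*[m-2] m) (dConst*4≡δ*[m-4] m) (P*2≡[m-2]*x*x-[m-4]*x m y)
    collect : ∀ a₀ a₁ a₂ p₀ p₁ p₂ k e →
              a₀ * (k * p₀ + e) + a₁ * (k * p₁ + e) + a₂ * (k * p₂ + e)
              ≡ k * (a₀ * p₀ + a₁ * p₁ + a₂ * p₂) + (a₀ + a₁ + a₂) * e
    collect = solve-∀

  Qcoset≡scale*f+offset : ∀ {m} → 3 ≤ m → ∀ a x → Qcoset m a x ≡ + scale m * f m a x + offset m a
  Qcoset≡scale*f+offset {m} 3≤m a x =
    trans (Qcoset≡δ*cConst*f+offset m a x)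
          (cong (λ s → s * f m a x + offset m a) (sym (+scale≡δ*cConst 3≤m)))

  P-nonNeg : ∀ {m} → 3 ≤ m → ∀ x → 0ℤ ℤ.≤ P m x
  P-nonNeg {m} (s≤s (s≤s (s≤s {n = k} _))) x = 0≤n⇒0≤n/d _ (+ 2) numerator≥0 (+≤+ z≤n)
    where
    split : ∀ K x → (K + + 3 - + 2) * x * x - (K + + 3 - + 4) * x
                  ≡ K * (x * (x - 1ℤ)) + (x + 1ℤ) * (x + 1ℤ - 1ℤ)
    split = solve-∀
    numerator≡ : (+ m - + 2) * x * x - (+ m - + 4) * x ≡ + k * (x * (x - 1ℤ)) + (x + 1ℤ) * (x + 1ℤ - 1ℤ)
    numerator≡ = trans (cong (λ M → (M - + 2) * x * x - (M - + 4) * x) (cong +_ (ℕ.+-comm 3 k))) (split (+ k) x)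
    numerator≥0 : 0ℤ ℤ.≤ (+ m - + 2) * x * x - (+ m - + 4) * x
    numerator≥0 = subst (0ℤ ℤ.≤_) (sym numerator≡)
                        (0≤i+j (0≤i*j {+ k} (+≤+ z≤n) (0≤i*[i-1] x)) (0≤i*[i-1] (x + 1ℤ)))

  f-nonNeg : ∀ {m} → 3 ≤ m → ∀ a x → 0ℤ ℤ.≤ f m a x
  f-nonNeg {m} 3≤m a x = 0≤i+j (0≤i+j (term zero) (term (suc zero))) (term (suc (suc zero)))
    where
    term : ∀ i → 0ℤ ℤ.≤ + a i * P m (x i)
    term i = 0≤i*j {+ a i} (+≤+ z≤n) (P-nonNeg 3≤m (x i))

  f[0]≡0 : ∀ m a → f m a (λ _ → 0ℤ) ≡ 0ℤ
  f[0]≡0 m a = trans (cong (λ p → + a zero * p + + a (suc zero) * p + + a (suc (suc zero)) * p) P[0]≡0)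
                     (vanish (+ a zero) (+ a (suc zero)) (+ a (suc (suc zero))))
    where
    P[0]≡0 : P m 0ℤ ≡ 0ℤ
    P[0]≡0 = cong (_/ + 2) (cong₂ (λ u v → u * 0ℤ - v) (ℤ.*-zeroʳ (+ m - + 2)) (ℤ.*-zeroʳ (+ m - + 4)))
    vanish : ∀ u v w → u * 0ℤ + v * 0ℤ + w * 0ℤ ≡ 0ℤ
    vanish = solve-∀

module _ where
  open import Data.Nat as ℕ using (_^_; NonZero; z≤n)
  open import Data.Nat.Divisibility as ℕ using (∣n⇒∣m*n; divides)
  import Data.Nat.Properties as ℕ
  open import Data.Nat.Primality using (Prime)
  open import Data.Integer as ℤ using (ℤ; +_; _+_; _-_; _*_; ∣_∣; +≤+)
  import Data.Integer.Properties as ℤ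
  open import Data.Integer.Divisibility using (_∣_)
  open import Algebra.Properties.AbelianGroup ℤ.+-0-abelianGroup using (∙-cancelʳ)
  open import Data.Product using (_×_; ∃)
  open import Relation.Binary.PropositionalEquality
  open import Data.Integer.Tactic.RingSolver using (solve-∀)

  LocallyRepresents : ((Fin 3 → ℤ) → ℤ) → ℤ → Set
  LocallyRepresents F n = ∀ p → Prime p → SolvableOverℤp p F n

  Regular : ((Fin 3 → ℤ) → ℤ) → Set
  Regular F = ∀ (n : ℕ) → LocallyRepresents F (+ n) → Represents F (+ n)

  IsMinimum : ((Fin 3 → ℤ) → ℤ) → ℤ → Set
  IsMinimum G μ = Represents G μ × (∀ x → μ ℤ.≤ G x)

  TightRegular : ((Fin 3 → ℤ) → ℤ) → Set
  TightRegular G = ∀ μ → IsMinimum G μ → ∀ n → μ ℤ.≤ n → LocallyRepresents G n → Represents G n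

  module AffineImage (F G : (Fin 3 → ℤ) → ℤ) (C : ℕ) .{{_ : NonZero C}} (D : ℤ)
                     (G≡C*F+D : ∀ x → G x ≡ + C * F x + D) where

    private
      ∣G-[C*n+D]∣ : ∀ x n → ∣ G x - (+ C * n + D) ∣ ≡ C ℕ.* ∣ F x - n ∣
      ∣G-[C*n+D]∣ x n = trans (cong (λ g → ∣ g - (+ C * n + D) ∣) (G≡C*F+D x))
                              (trans (cong ∣_∣ (factor (+ C) (F x) n D)) (ℤ.abs-* (+ C) (F x - n)))
        where
        factor : ∀ c y n d → c * y + d - (c * n + d) ≡ c * (y - n)
        factor = solve-∀

      G-n≡C*F-[n-D] : ∀ x n → G x - n ≡ + C * F x - (n - D)
      G-n≡C*F-[n-D] x n = trans (cong (_- n) (G≡C*F+D x)) (shift (+ C * F x) n D)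
        where
        shift : ∀ y n d → y + d - n ≡ y - (n - d)
        shift = solve-∀

    solvesAt-G : ∀ {p x n} → SolvesAt p F x n → SolvesAt p G x (+ C * n + D)
    solvesAt-G {p} {x} {n} solves j with solves j
    ... | K , conv = K , λ k K≤k →
      subst (p ^ j ℕ.∣_) (sym (∣G-[C*n+D]∣ _ n)) (∣n⇒∣m*n C (conv k K≤k))

    solvesAt-F : ∀ {p x n} → Prime p → SolvesAt p G x (+ C * n + D) → SolvesAt p F x n
    solvesAt-F {p} {x} {n} p-prime solves j with solves (C ℕ.+ j)
    ... | K , conv = K , λ k K≤k →
      p^[m+j]∣m*n⇒p^j∣n p-prime j (subst (p ^ (C ℕ.+ j) ℕ.∣_) (∣G-[C*n+D]∣ _ n) (conv k K≤k))

    locally-F⇒locally-G : ∀ {n} → LocallyRepresents F n → LocallyRepresents G (+ C * n + D)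
    locally-F⇒locally-G {n} loc p p-prime with loc p p-prime
    ... | x , solves = x , solvesAt-G {p} {x} {n} solves

    locally-G⇒locally-F : ∀ {n} → LocallyRepresents G (+ C * n + D) → LocallyRepresents F n
    locally-G⇒locally-F {n} loc p p-prime with loc p p-prime
    ... | x , solves = x , solvesAt-F {p} {x} {n} p-prime solves

    locally-G⇒C∣n-D : ∀ {n} → LocallyRepresents G n → + C ∣ n - D
    locally-G⇒C∣n-D {n} loc = solvableModPrimePowers⇒∣ C (n - D) congruence
      where
      congruence : SolvableModPrimePowers C (n - D)
      congruence p p-prime j with loc p p-prime
      ... | x , solves with solves j
      ... | K , conv = F xₖ , subst (+ (p ^ j) ∣_) (G-n≡C*F-[n-D] xₖ n) (conv K ℕ.≤-refl)
        where xₖ = λ i → seq (x i) K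

    D≤C*i+D : ∀ {i} → 0ℤ ℤ.≤ i → D ℤ.≤ + C * i + D
    D≤C*i+D {i} 0≤i = ℤ.i≤j+i D (+ C * i) {{ℤ.nonNegative (0≤i*j {+ C} (+≤+ z≤n) 0≤i)}}

    D≤n∧C∣n-D⇒n≡C*q+D : ∀ {n} → D ℤ.≤ n → + C ∣ n - D → ∃ λ q → n ≡ + C * + q + D
    D≤n∧C∣n-D⇒n≡C*q+D {n} D≤n (divides q ∣n-D∣≡q*C) = q , (begin
      n                ≡⟨ split n D ⟩
      (n - D) + D      ≡⟨ cong (_+ D) (ℤ.0≤i⇒+∣i∣≡i (ℤ.i≤j⇒0≤j-i D≤n)) ⟨
      + ∣ n - D ∣ + D  ≡⟨ cong (λ k → + k + D) (trans ∣n-D∣≡q*C (ℕ.*-comm q C)) ⟩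
      + (C ℕ.* q) + D  ≡⟨ cong (_+ D) (ℤ.pos-* C q) ⟩
      + C * + q + D    ∎)
      where
      open ≡-Reasoning
      split : ∀ n d → n ≡ (n - d) + d
      split = solve-∀

    module _ (F≥0 : ∀ x → 0ℤ ℤ.≤ F x) (x₀ : Fin 3 → ℤ) (Fx₀≡0 : F x₀ ≡ 0ℤ) where

      D≤G : ∀ x → D ℤ.≤ G x
      D≤G x = subst (D ℤ.≤_) (sym (G≡C*F+D x)) (D≤C*i+D (F≥0 x))

      D-isMinimum : IsMinimum G D
      D-isMinimum = (x₀ , Gx₀≡D) , D≤G
        where
        Gx₀≡D : G x₀ ≡ D
        Gx₀≡D = begin
          G x₀           ≡⟨ G≡C*F+D x₀ ⟩
          + C * F x₀ + D ≡⟨ cong (λ v → + C * v + D) Fx₀≡0 ⟩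
          + C * 0ℤ + D   ≡⟨ cong (_+ D) (ℤ.*-zeroʳ (+ C)) ⟩
          0ℤ + D         ≡⟨ ℤ.+-identityˡ D ⟩
          D              ∎
          where open ≡-Reasoning

      regular⇒tightRegular : Regular F → TightRegular G
      regular⇒tightRegular regular μ ((y , Gy≡μ) , _) n μ≤n loc
        with D≤n∧C∣n-D⇒n≡C*q+D (ℤ.≤-trans (subst (D ℤ.≤_) Gy≡μ (D≤G y)) μ≤n) (locally-G⇒C∣n-D loc)
      ... | q , refl with regular q (locally-G⇒locally-F loc)
      ... | x , Fx≡q = x , trans (G≡C*F+D x) (cong (λ v → + C * v + D) Fx≡q)

      tightRegular⇒regular : TightRegular G → Regular F
      tightRegular⇒regular tight n loc
        with tight D D-isMinimum (+ C * + n + D) (D≤C*i+D (+≤+ z≤n)) (locally-F⇒locally-G loc)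
      ... | x , Gx≡C*n+D =
        x , ℤ.*-cancelˡ-≡ (+ C) _ _ (∙-cancelʳ D _ _ (trans (sym (G≡C*F+D x)) Gx≡C*n+D))

      regular⇔tightRegular : Regular F ⇔ TightRegular G
      regular⇔tightRegular = mk⇔ regular⇒tightRegular tightRegular⇒regular

proposition3p1 : (m : ℕ) → 3 ≤ m → (a : Fin 3 → ℕ) → (∀ i → 0 < a i) →
    IsRegular m a ⇔ IsTightRegular m a
proposition3p1 m 3≤m a _ = regular⇔tightRegular (f-nonNeg 3≤m a) (λ _ → 0ℤ) (f[0]≡0 m a)
  where
  open AffineImage (f m a) (Qcoset m a) (scale m) {{scale-nonZero 3≤m}} (offset m a)
                   (Qcoset≡scale*f+offset 3≤m a)
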